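{- Let $D=(V,E)$ be a strongly connected directed graph (multiple edges allowed) with a fixed cyclic ordering of the out-edges at each vertex, and let $(w,\varrho)$ be a unicycle on $D$. If we iterate the rotor-router operation starting from $(w,\varrho)$ until we first arrive back at $(w,\varrho)$, then each vertex $v$ is reached ${\rm per}_D(v)\, d^+(v)$ times by the chip. Therefore the rotor at each vertex $v$ makes exactly ${\rm per}_D(v)$ full turns, each edge $(u,v)$ is traversed ${\rm per}_D(u)$ times (counted with multiplicity for each parallel edge), and the length of the period is $\sum_{v\in V}{\rm per}_D(v)\, d^+(v)$.
   Context: $d^+(v)$ and $d^-(v)$ denote out- and in-degree. At each vertex $v$ a cyclic ordering of the outgoing edges is fixed; for an edge $e$ with tail $v$, $e^+$ denotes the edge following $e$ in this cyclic order. A rotor configuration $\varrho$ assigns to each vertex $v$ an out-edge $\varrho(v)$ with tail $v$. A chip-and-rotor configuration is a pair $(w,\varrho)$ with $w\in V$ (a chip placed on $w$) and $\varrho$ a rotor configuration. The rotor-router operation sends $(w,\varrho)$ to $(w^+,\varrho^+)$, where $\varrho^+(v)=\varrho(v)$ for $v\neq w$, $\varrho^+(w)=\varrho(w)^+$, and $w^+$ is the head of $\varrho^+(w)$. A unicycle is a chip-and-rotor configuration $(w,\varrho)$ such that the edge set $\{\varrho(v):v\in V\}$ contains a unique directed cycle and $w$ lies on this cycle. Identify $V$ with $\{1,\dots,n\}$. The Laplacian $L_D$ is the $n\times n$ matrix with $L_D(i,i)=-d^+(i)$ and $L_D(i,j)=d(j,i)$ for $i\neq j$, where $d(j,i)$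 is the number of edges from $j$ to $i$. Since $D$ is strongly connected, $\ker L_D$ is one-dimensional; the period vector ${\rm per}_D$ is the unique vector $x\in\mathbb{Z}^n$ with $L_Dx=0$ whose entries are positive and have no nontrivial common divisor. ${\rm per}_D(v)$ denotes its $v$-coordinate. -}

module Defs where

open import Data.Nat using (ℕ; zero; suc; _+_; _*_; _≤_; _<_)
open import Data.Nat.Divisibility using (_∣_)
open import Data.Fin using (Fin; _≟_)
open import Data.Integer as ℤ using (ℤ; +_)
open import Data.List using (List; []; _∷_; map; filter; length; allFin; upTo; foldr)
open import Data.List.Membership.Propositional using (_∈_)
open import Data.List.Relation.Unary.All using (All)
open import Data.List.Relation.Unary.Unique.Propositional using (Unique)
open import Data.Product using (Σ; ∃; _×_; _,_; proj₁; proj₂)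
open import Data.Bool using (if_then_else_)
open import Function using (_∘_)
open import Relation.Nullary using (¬_; does)
open import Relation.Binary.PropositionalEquality using (_≡_; _≢_)

record Digraph : Set where
  field
    nV     : ℕ
    nE     : ℕ
    tail   : Fin nE → Fin nV
    head   : Fin nE → Fin nV

open Digraph public

module _ (D : Digraph) where

  Vtx : Set
  Vtx = Fin (nV D)

  Edge : Set
  Edge = Fin (nE D)

  outdeg : Vtx → ℕ
  outdeg v = length (filter (λ e → tail D e ≟ v) (allFin (nE D)))

  nEdges : Vtx → Vtx → ℕ
  nEdges j i = length (filter (λ e → tail D e ≟ j) (filter (λ e → head D e ≟ i) (allFin (nE D))))

  WalkL : Vtx → List Edge → Vtx → Set
  WalkL u []       v = u ≡ v
  WalkL u (e ∷ es) v = (tail D e ≡ u) × WalkL (head D e) es v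

  StronglyConnected : Set
  StronglyConnected = ∀ (u v : Vtx) → ∃ λ es → WalkL u es v

  -- nxt e = e⁺ : a cyclic ordering of the out-edges at each vertex:
  -- nxt preserves tails, and iterating nxt from any out-edge of v
  -- reaches every out-edge of v (so nxt is a single cycle on them).
  iter : ℕ → (Edge → Edge) → Edge → Edge
  iter zero    f e = e
  iter (suc k) f e = f (iter k f e)

  IsCyclicOrdering : (Edge → Edge) → Set
  IsCyclicOrdering nxt =
    (∀ e → tail D (nxt e) ≡ tail D e) ×
    (∀ e e′ → tail D e ≡ tail D e′ → ∃ λ k → iter k nxt e ≡ e′)

  IsRotorConfig : (Vtx → Edge) → Set
  IsRotorConfig ρ = ∀ v → tail D (ρ v) ≡ v

  InRotorSet : (Vtx → Edge) → Edge → Set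
  InRotorSet ρ e = ∃ λ v → ρ v ≡ e

  IsCycleIn : (Edge → Set) → List Edge → Set
  IsCycleIn S es =
    (es ≢ []) × (∃ λ u → WalkL u es u) × Unique (map (tail D) es) × All S es

  -- a unicycle: the edge set of ρ contains a unique directed cycle
  -- (unique as a set of edges), and w lies on it
  IsUnicycle : Vtx → (Vtx → Edge) → Set
  IsUnicycle w ρ =
    Σ (List Edge) λ es →
      IsCycleIn (InRotorSet ρ) es ×
      (w ∈ map (tail D) es) ×
      (∀ es′ → IsCycleIn (InRotorSet ρ) es′ → ∀ e → ((e ∈ es → e ∈ es′) × (e ∈ es′ → e ∈ es)))

  sumℤ : List ℤ → ℤ
  sumℤ = foldr ℤ._+_ (+ 0)

  Laplacian : Vtx → Vtx → ℤ
  Laplacian i j = if does (i ≟ j) then ℤ.- (+ outdeg i) else + nEdges j i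

  IsPeriodVector : (Vtx → ℕ) → Set
  IsPeriodVector x =
    (∀ v → 0 < x v) ×
    (∀ i → sumℤ (map (λ j → Laplacian i j ℤ.* + x j) (allFin (nV D))) ≡ + 0) ×
    (∀ d → (∀ v → d ∣ x v) → d ≡ 1)

  Config : Set
  Config = Vtx × (Vtx → Edge)

  update : (Vtx → Edge) → Vtx → Edge → (Vtx → Edge)
  update ρ w e v = if does (v ≟ w) then e else ρ v

  rotorStep : (Edge → Edge) → Config → Config
  rotorStep nxt (w , ρ) = head D (nxt (ρ w)) , update ρ w (nxt (ρ w))

  run : (Edge → Edge) → Config → ℕ → Config
  run nxt c zero    = c
  run nxt c (suc k) = rotorStep nxt (run nxt c k)

  _≈C_ : Config → Config → Set
  (w , ρ) ≈C (w′ , ρ′) = (w ≡ w′) × (∀ v → ρ v ≡ ρ′ v)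

  IsFirstReturn : (Edge → Edge) → Config → ℕ → Set
  IsFirstReturn nxt c T =
    (1 ≤ T) × (run nxt c T ≈C c) × (∀ k → 1 ≤ k → k < T → ¬ (run nxt c k ≈C c))

  visits : (Edge → Edge) → Config → ℕ → Vtx → ℕ
  visits nxt c T v = length (filter (λ i → proj₁ (run nxt c i) ≟ v) (upTo T))

  -- the edge traversed in step i → i+1 is (ρ_{i+1})(w_i) = ρ_i(w_i)⁺
  traversed : (Edge → Edge) → Config → ℕ → Edge
  traversed nxt c i = nxt (proj₂ (run nxt c i) (proj₁ (run nxt c i)))

  traversals : (Edge → Edge) → Config → ℕ → Edge → ℕ
  traversals nxt c T e = length (filter (λ i → traversed nxt c i ≟ e) (upTo T))

-- The rotor at v advances once per departure from v, so after per(v)·d⁺(v) departures it has made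
-- per(v) full turns and crossed each out-edge of v exactly per(v) times.  As long as no vertex has
-- exceeded this quota, the arrivals at v are therefore at most Σ_{e : u → v} per(u) = per(v)·d⁺(v),
-- by the kernel equation.  When the chip sits at a vertex whose quota is used up, counting arrivals
-- shows that it sits at w, and every vertex with quota left passes this on to the vertex its rotor
-- points to.  In a unicycle every rotor path leads to w, so all quotas are used up, which happens
-- exactly at time τ = Σ_v per(v)·d⁺(v), and the configuration is back at (w, ρ).  A return at an
-- earlier time k makes departures/d⁺ a balanced vector between 0 and per; since the kernel of L_D
-- is a line and per is primitive, that vector is 0 or per, i.e. k = 0 or k = τ.
module Submission where

open import Defs
open import Level using (Level)
open import Data.Empty using (⊥-elim)
open import Data.Fin using (Fin; zero; suc; toℕ; _≟_)
open import Data.Fin.Properties using (pigeonhole)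
import Data.Integer as ℤ
import Data.Integer.Properties as ℤₚ
open import Data.Integer.Tactic.RingSolver using (solve-∀)
open import Data.List using (List; []; _∷_; _++_; map; filter; length; upTo; allFin; tabulate; applyUpTo)
open import Data.List.Properties using (upTo-∷ʳ; map-++; map-tabulate; map-cong; map-applyUpTo; length-applyUpTo)
open import Data.List.Membership.Propositional using (_∈_)
open import Data.List.Membership.Propositional.Properties using (∈-allFin; ∈-map⁻; ∈-applyUpTo⁻)
import Data.List.Relation.Unary.All.Properties as All
open import Data.List.Relation.Unary.Any using (here; there)
open import Data.List.Relation.Unary.Unique.Propositional using (Unique)
import Data.List.Relation.Unary.Unique.Propositional.Properties as Unique
open import Data.Nat hiding (_≟_; _^_)
open import Data.Nat.Coprimality using (coprime-/gcd; coprime-divisor)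
open import Data.Nat.DivMod using (_%_; _/_; m≡m%n+[m/n]*n; m%n<n; m<n*o⇒m/o<n; m/n*n≡m)
open import Data.Nat.Divisibility using (_∣_; divides; m%n≡0⇒n∣m)
open import Data.Nat.GCD using (gcd; gcd[m,n]∣m; gcd[m,n]∣n; gcd[m,n]≢0)
open import Data.Nat.ListAction using (sum)
open import Data.Nat.ListAction.Properties using (sum-++)
open import Data.Nat.Properties hiding (_≟_)
open import Algebra.Properties.CommutativeSemigroup *-commutativeSemigroup
  using (x∙yz≈y∙xz; x∙yz≈xz∙y; xy∙z≈xz∙y; xy∙z≈zx∙y; xy∙z≈y∙xz)
open import Algebra.Properties.CommutativeSemigroup +-commutativeSemigroup
  using () renaming (xy∙z≈xz∙y to x+y+z≡x+z+y)
open import Algebra.Properties.Semiring.Sum +-*-semiring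
  using (sum-syntax; ∑-comm; ∑-distrib-+; *-distribˡ-sum; *-distribʳ-sum; sum-cong-≗; sum-replicate-zero)
  renaming (sum to ∑)
open import Data.Product using (Σ; ∃; _×_; _,_; proj₁; proj₂)
open import Data.Sum using (_⊎_; inj₁; inj₂)
import Data.Sum as Sum
open import Function using (_∘_; id)
open import Relation.Binary.Core using (Rel)
open import Relation.Binary.Definitions using (DecidableEquality; Transitive; Total; tri<; tri≈; tri>)
open import Relation.Binary.PropositionalEquality
open import Relation.Nullary using (Dec; yes; no; ¬_; _×-dec_)
open import Relation.Unary using (Pred; Decidable)

private variable
  a p : Level
  A : Set a
  P : Set p

-- Iverson brackets and finite sums

𝟙 : Dec P → ℕ
𝟙 (yes _) = 1
𝟙 (no _)  = 0

𝟙-yes : (P? : Dec P) → P → 𝟙 P? ≡ 1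
𝟙-yes (yes _) _  = refl
𝟙-yes (no ¬p) p′ = ⊥-elim (¬p p′)

𝟙-no : (P? : Dec P) → ¬ P → 𝟙 P? ≡ 0
𝟙-no (yes p′) ¬p = ⊥-elim (¬p p′)
𝟙-no (no _)   _  = refl

𝟙≤1 : (P? : Dec P) → 𝟙 P? ≤ 1
𝟙≤1 (yes _) = s≤s z≤n
𝟙≤1 (no _)  = z≤n

𝟙≡1⇒ : (P? : Dec P) → 𝟙 P? ≡ 1 → P
𝟙≡1⇒ (yes p′) _ = p′

length-filter≡sum-𝟙 : {Q : Pred A p} (Q? : Decidable Q) (xs : List A) →
  length (filter Q? xs) ≡ sum (map (𝟙 ∘ Q?) xs)
length-filter≡sum-𝟙 Q? [] = refl
length-filter≡sum-𝟙 Q? (x ∷ xs) with Q? x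
... | yes _ = cong suc (length-filter≡sum-𝟙 Q? xs)
... | no _  = length-filter≡sum-𝟙 Q? xs

sum-map-filter : {Q : Pred A p} (Q? : Decidable Q) (g : A → ℕ) (xs : List A) →
  sum (map g (filter Q? xs)) ≡ sum (map (λ x → 𝟙 (Q? x) * g x) xs)
sum-map-filter Q? g [] = refl
sum-map-filter Q? g (x ∷ xs) with Q? x
... | yes _ = cong₂ _+_ (sym (+-identityʳ (g x))) (sum-map-filter Q? g xs)
... | no _  = sum-map-filter Q? g xs

sum-map-allFin : ∀ n (f : Fin n → ℕ) → sum (map f (allFin n)) ≡ ∑[ i < n ] f i
sum-map-allFin zero    f = refl
sum-map-allFin (suc n) f = cong (f zero +_) (begin
  sum (map f (tabulate suc))  ≡⟨ cong sum (map-tabulate suc f) ⟩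
  sum (tabulate (f ∘ suc))    ≡⟨ cong sum (map-tabulate id (f ∘ suc)) ⟨
  sum (map (f ∘ suc) (allFin n)) ≡⟨ sum-map-allFin n (f ∘ suc) ⟩
  ∑[ i < n ] f (suc i)        ∎)
  where open ≡-Reasoning

∑-pick : ∀ {n} (i : Fin n) (f : Fin n → ℕ) → ∑[ j < n ] (𝟙 (i ≟ j) * f j) ≡ f i
∑-pick {suc n} zero f = begin
  f zero + 0 * f zero + (∑[ j < n ] (𝟙 (zero ≟ suc j) * f (suc j)))
    ≡⟨ cong (f zero + 0 * f zero +_) (sum-cong-≗ {n} (λ j → cong (_* f (suc j)) (𝟙-no (zero ≟ suc j) λ ()))) ⟩
  f zero + 0 + (∑[ j < n ] 0) ≡⟨ cong₂ _+_ (+-identityʳ (f zero)) (sum-replicate-zero n) ⟩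
  f zero + 0                ≡⟨ +-identityʳ (f zero) ⟩
  f zero                    ∎
  where open ≡-Reasoning
∑-pick {suc n} (suc i) f = trans (sum-cong-≗ {n} shift) (∑-pick i (f ∘ suc))
  where
  shift : ∀ j → 𝟙 (suc i ≟ suc j) * f (suc j) ≡ 𝟙 (i ≟ j) * f (suc j)
  shift j with i ≟ j
  ... | yes refl = refl
  ... | no _     = refl

∑-𝟙 : ∀ {n} (i : Fin n) → ∑[ j < n ] 𝟙 (i ≟ j) ≡ 1
∑-𝟙 {n} i = trans (sum-cong-≗ {n} λ j → sym (*-identityʳ (𝟙 (i ≟ j)))) (∑-pick i λ _ → 1)

∑-mono-≤ : ∀ {n} {f g : Fin n → ℕ} → (∀ i → f i ≤ g i) → ∑ f ≤ ∑ g
∑-mono-≤ {zero}  _   = z≤n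
∑-mono-≤ {suc n} f≤g = +-mono-≤ (f≤g zero) (∑-mono-≤ (f≤g ∘ suc))

∑-mono-< : ∀ {n} {f g : Fin n → ℕ} → (∀ i → f i ≤ g i) → ∀ i → f i < g i → ∑ f < ∑ g
∑-mono-< {suc n} f≤g zero    f<g = +-mono-<-≤ f<g (∑-mono-≤ (f≤g ∘ suc))
∑-mono-< {suc n} f≤g (suc i) f<g = +-mono-≤-< (f≤g zero) (∑-mono-< (f≤g ∘ suc) i f<g)

∑≡∑⇒≗ : ∀ {n} {f g : Fin n → ℕ} → (∀ i → f i ≤ g i) → ∑ f ≡ ∑ g → ∀ i → f i ≡ g i
∑≡∑⇒≗ f≤g ∑f≡∑g i with m≤n⇒m<n∨m≡n (f≤g i)
... | inj₁ f<g = ⊥-elim (<⇒≢ (∑-mono-< f≤g i f<g) ∑f≡∑g)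
... | inj₂ f≡g = f≡g

≤∑ : ∀ {n} (f : Fin n → ℕ) (i : Fin n) → f i ≤ ∑ f
≤∑ f zero    = m≤m+n (f zero) _
≤∑ f (suc i) = ≤-trans (≤∑ (f ∘ suc) i) (m≤n+m _ (f zero))

Σ< : ℕ → (ℕ → ℕ) → ℕ
Σ< zero    f = 0
Σ< (suc t) f = Σ< t f + f t

sum-map-upTo : (f : ℕ → ℕ) (t : ℕ) → sum (map f (upTo t)) ≡ Σ< t f
sum-map-upTo f zero    = refl
sum-map-upTo f (suc t) = begin
  sum (map f (upTo (suc t)))        ≡⟨ cong (sum ∘ map f) (upTo-∷ʳ t) ⟨
  sum (map f (upTo t ++ t ∷ []))    ≡⟨ cong sum (map-++ f (upTo t) (t ∷ [])) ⟩
  sum (map f (upTo t) ++ f t ∷ [])  ≡⟨ sum-++ (map f (upTo t)) (f t ∷ []) ⟩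
  sum (map f (upTo t)) + (f t + 0)  ≡⟨ cong₂ _+_ (sum-map-upTo f t) (+-identityʳ (f t)) ⟩
  Σ< t f + f t                      ∎
  where open ≡-Reasoning

Σ<-cong : {f g : ℕ → ℕ} → (∀ i → f i ≡ g i) → ∀ t → Σ< t f ≡ Σ< t g
Σ<-cong f≗g zero    = refl
Σ<-cong f≗g (suc t) = cong₂ _+_ (Σ<-cong f≗g t) (f≗g t)

Σ<-∑-comm : ∀ {n} t (g : ℕ → Fin n → ℕ) → Σ< t (λ i → ∑[ a < n ] g i a) ≡ ∑[ a < n ] Σ< t (λ i → g i a)
Σ<-∑-comm {n} zero    g = sym (sum-replicate-zero n)
Σ<-∑-comm     (suc t) g = trans (cong (_+ ∑ (g t)) (Σ<-∑-comm t g)) (sym (∑-distrib-+ _ (g t)))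

Σ<-const-1 : ∀ t → Σ< t (λ _ → 1) ≡ t
Σ<-const-1 zero    = refl
Σ<-const-1 (suc t) = trans (cong (_+ 1) (Σ<-const-1 t)) (+-comm t 1)

Σ<-*ˡ : ∀ c (f : ℕ → ℕ) t → Σ< t (λ i → c * f i) ≡ c * Σ< t f
Σ<-*ˡ c f zero    = sym (*-zeroʳ c)
Σ<-*ˡ c f (suc t) = trans (cong (_+ c * f t) (Σ<-*ˡ c f t)) (sym (*-distribˡ-+ c _ (f t)))

Σ<-+ : ∀ (f : ℕ → ℕ) m t → Σ< (m + t) f ≡ Σ< m f + Σ< t (λ i → f (m + i))
Σ<-+ f m zero    = trans (cong (λ k → Σ< k f) (+-identityʳ m)) (sym (+-identityʳ _))
Σ<-+ f m (suc t) = begin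
  Σ< (m + suc t) f                               ≡⟨ cong (λ k → Σ< k f) (+-suc m t) ⟩
  Σ< (m + t) f + f (m + t)                       ≡⟨ cong (_+ f (m + t)) (Σ<-+ f m t) ⟩
  Σ< m f + Σ< t (λ i → f (m + i)) + f (m + t)    ≡⟨ +-assoc (Σ< m f) _ _ ⟩
  Σ< m f + Σ< (suc t) (λ i → f (m + i))          ∎
  where open ≡-Reasoning

Σ<-mono : ∀ {t k} (f : ℕ → ℕ) → t ≤ k → Σ< t f ≤ Σ< k f
Σ<-mono {t} {k} f t≤k = begin
  Σ< t f                                ≤⟨ m≤m+n (Σ< t f) _ ⟩
  Σ< t f + Σ< (k ∸ t) (λ i → f (t + i)) ≡⟨ Σ<-+ f t (k ∸ t) ⟨
  Σ< (t + (k ∸ t)) f                    ≡⟨ cong (λ j → Σ< j f) (m+[n∸m]≡n t≤k) ⟩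
  Σ< k f                                ∎
  where open ≤-Reasoning

≤Σ< : ∀ {k t} (f : ℕ → ℕ) → k < t → f k ≤ Σ< t f
≤Σ< {k} f k<t = ≤-trans (m≤n+m (f k) (Σ< k f)) (Σ<-mono f k<t)

Σ<-zero : (f : ℕ → ℕ) → ∀ t → (∀ {i} → i < t → f i ≡ 0) → Σ< t f ≡ 0
Σ<-zero f zero    _  = refl
Σ<-zero f (suc t) f≡0 = cong₂ _+_ (Σ<-zero f t (f≡0 ∘ m<n⇒m<1+n)) (f≡0 (n<1+n t))

Σ<-𝟙≤1 : {Q : ℕ → Set p} (Q? : Decidable Q) → ∀ t →
  (∀ {i j} → i < t → j < t → Q i → Q j → i ≡ j) → Σ< t (𝟙 ∘ Q?) ≤ 1
Σ<-𝟙≤1 Q? zero    _      = z≤n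
Σ<-𝟙≤1 Q? (suc t) unique with Q? t
... | no _  = ≤-trans (≤-reflexive (+-identityʳ _)) (Σ<-𝟙≤1 Q? t λ i<t j<t → unique (m<n⇒m<1+n i<t) (m<n⇒m<1+n j<t))
... | yes q = ≤-reflexive (cong (_+ 1) (Σ<-zero (𝟙 ∘ Q?) t none))
  where
  none : ∀ {i} → i < t → 𝟙 (Q? i) ≡ 0
  none {i} i<t = 𝟙-no (Q? i) λ qi → <⇒≢ i<t (unique (m<n⇒m<1+n i<t) (n<1+n t) qi q)

Σ<-periodic : ∀ {f : ℕ → ℕ} {p} → (∀ i → f (p + i) ≡ f i) → ∀ c r → Σ< (c * p + r) f ≡ c * Σ< p f + Σ< r f
Σ<-periodic {f} {p} f-periodic c r =
  trans (Σ<-+ f (c * p) r) (cong₂ _+_ (Σ<-multiple c) (Σ<-cong (shift c) r))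
  where
  shift : ∀ c i → f (c * p + i) ≡ f i
  shift zero    i = refl
  shift (suc c) i = trans (cong f (+-assoc p (c * p) i)) (trans (f-periodic (c * p + i)) (shift c i))
  Σ<-multiple : ∀ c → Σ< (c * p) f ≡ c * Σ< p f
  Σ<-multiple zero    = refl
  Σ<-multiple (suc c) = trans (Σ<-+ f p (c * p)) (cong (Σ< p f +_) (trans (Σ<-cong f-periodic (c * p)) (Σ<-multiple c)))

-- Iterates and minimal periods

least-witness : ∀ {n} {P : ℕ → Set p} → Decidable P → P n →
  ∃ λ m → P m × (∀ {k} → k < m → ¬ P k)
least-witness {n = n} {P = P} P? pn = search n 0 (+-identityʳ n) (λ ())
  where
  search : ∀ fuel m → fuel + m ≡ n → (∀ {k} → k < m → ¬ P k) → ∃ λ m → P m × (∀ {k} → k < m → ¬ P k)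
  search zero    m refl below = m , pn , below
  search (suc fuel) m eq below with P? m
  ... | yes pm = m , pm , below
  ... | no ¬pm = search fuel (suc m) (trans (+-suc fuel m) eq) below′
    where
    below′ : ∀ {k} → k < suc m → ¬ P k
    below′ k<1+m with m<1+n⇒m<n∨m≡n k<1+m
    ... | inj₁ k<m  = below k<m
    ... | inj₂ refl = ¬pm

module _ {A : Set a} where
  open import Function.Endo.Propositional A public using (_^_; ^-homo)

^-+ : (f : A → A) (m n : ℕ) (x : A) → (f ^ (m + n)) x ≡ (f ^ m) ((f ^ n) x)
^-+ f m n = cong-app (^-homo f m n)

record IsMinimalPeriod {A : Set a} (f : A → A) (x : A) (q : ℕ) : Set a where
  field
    positive : 0 < q
    returns  : (f ^ q) x ≡ x
    minimal  : ∀ {j} → 0 < j → j < q → (f ^ j) x ≢ x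

minimalPeriod : ∀ {n} → DecidableEquality A → (f : A → A) (x : A) → 0 < n → (f ^ n) x ≡ x →
  ∃ (IsMinimalPeriod f x)
minimalPeriod _≟_ f x 0<n fⁿx≡x with least-witness returns? (0<n , fⁿx≡x)
  where
  returns? : Decidable λ j → 0 < j × (f ^ j) x ≡ x
  returns? j = 0 <? j ×-dec (f ^ j) x ≟ x
... | q , (0<q , fᵍx≡x) , below = q , record
  { positive = 0<q ; returns = fᵍx≡x ; minimal = λ 0<j j<q fʲx≡x → below j<q (0<j , fʲx≡x) }

module IsMinimalPeriodProperties {A : Set a} {f : A → A} {x : A} {q : ℕ}
  (period : IsMinimalPeriod f x q) where

  open IsMinimalPeriod period

  instance
    q≢0 : NonZero q
    q≢0 = >-nonZero positive

  ^-*-period : ∀ c → (f ^ (c * q)) x ≡ x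
  ^-*-period zero    = refl
  ^-*-period (suc c) = trans (^-+ f q (c * q) x) (trans (cong (f ^ q) (^-*-period c)) returns)

  ^-periodic : ∀ k → (f ^ (q + k)) x ≡ (f ^ k) x
  ^-periodic k = trans (cong (λ j → (f ^ j) x) (+-comm q k)) (trans (^-+ f k q x) (cong (f ^ k) returns))

  ^-mod-period : ∀ k → (f ^ k) x ≡ (f ^ (k % q)) x
  ^-mod-period k = begin
    (f ^ k) x                               ≡⟨ cong (λ j → (f ^ j) x) (m≡m%n+[m/n]*n k q) ⟩
    (f ^ (k % q + k / q * q)) x             ≡⟨ ^-+ f (k % q) (k / q * q) x ⟩
    (f ^ (k % q)) ((f ^ (k / q * q)) x)     ≡⟨ cong (f ^ (k % q)) (^-*-period (k / q)) ⟩
    (f ^ (k % q)) x                         ∎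
    where open ≡-Reasoning

  period-∣ : ∀ {k} → (f ^ k) x ≡ x → q ∣ k
  period-∣ {k} fᵏx≡x with k % q in k%q
  ... | zero  = m%n≡0⇒n∣m k q k%q
  ... | suc r = ⊥-elim (minimal z<s (subst (_< q) k%q (m%n<n k q))
                  (trans (cong (λ j → (f ^ j) x) (sym k%q)) (trans (sym (^-mod-period k)) fᵏx≡x)))

  private
    ^-distinct : ∀ {i j} → i < j → j < q → (f ^ i) x ≢ (f ^ j) x
    ^-distinct {i} {j} i<j j<q fⁱx≡fʲx = minimal 0<r r<q fʳx≡x
      where
      r : ℕ
      r = q ∸ j + i
      0<r : 0 < r
      0<r = ≤-trans (m<n⇒0<n∸m j<q) (m≤m+n (q ∸ j) i)
      r<q : r < q
      r<q = begin-strict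
        q ∸ j + i <⟨ +-monoʳ-< (q ∸ j) i<j ⟩
        q ∸ j + j ≡⟨ m∸n+n≡m (<⇒≤ j<q) ⟩
        q         ∎
        where open ≤-Reasoning
      fʳx≡x : (f ^ r) x ≡ x
      fʳx≡x = begin
        (f ^ (q ∸ j + i)) x         ≡⟨ ^-+ f (q ∸ j) i x ⟩
        (f ^ (q ∸ j)) ((f ^ i) x)   ≡⟨ cong (f ^ (q ∸ j)) fⁱx≡fʲx ⟩
        (f ^ (q ∸ j)) ((f ^ j) x)   ≡⟨ ^-+ f (q ∸ j) j x ⟨
        (f ^ (q ∸ j + j)) x         ≡⟨ cong (λ k → (f ^ k) x) (m∸n+n≡m (<⇒≤ j<q)) ⟩
        (f ^ q) x                   ≡⟨ returns ⟩
        x                           ∎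
        where open ≡-Reasoning

  ^-injective : ∀ {i j} → i < q → j < q → (f ^ i) x ≡ (f ^ j) x → i ≡ j
  ^-injective {i} {j} i<q j<q fⁱx≡fʲx with <-cmp i j
  ... | tri< i<j _ _ = ⊥-elim (^-distinct i<j j<q fⁱx≡fʲx)
  ... | tri≈ _ i≡j _ = i≡j
  ... | tri> _ _ j<i = ⊥-elim (^-distinct j<i i<q (sym fⁱx≡fʲx))

-- The Laplacian and balanced vectors

module _ (D : Digraph) where

  open ℤ using (+_)

  private
    n m : ℕ
    n = nV D
    m = nE D

  sumℤ-⊖ : (f g : A → ℕ) (xs : List A) →
    sumℤ D (map (λ x → + f x ℤ.- + g x) xs) ≡ + sum (map f xs) ℤ.- + sum (map g xs)
  sumℤ-⊖ f g [] = refl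
  sumℤ-⊖ f g (x ∷ xs) = begin
    (+ f x ℤ.- + g x) ℤ.+ sumℤ D (map (λ x → + f x ℤ.- + g x) xs)
      ≡⟨ cong (λ s → (+ f x ℤ.- + g x) ℤ.+ s) (sumℤ-⊖ f g xs) ⟩
    (+ f x ℤ.- + g x) ℤ.+ (+ F ℤ.- + G)   ≡⟨ rearrange (+ f x) (+ g x) (+ F) (+ G) ⟩
    (+ f x ℤ.+ + F) ℤ.- (+ g x ℤ.+ + G)   ≡⟨ cong₂ ℤ._-_ (ℤₚ.pos-+ (f x) F) (ℤₚ.pos-+ (g x) G) ⟨
    + (f x + F) ℤ.- + (g x + G)           ∎
    where
    open ≡-Reasoning
    F G : ℕ
    F = sum (map f xs)
    G = sum (map g xs)
    rearrange : ∀ a b c d → (a ℤ.- b) ℤ.+ (c ℤ.- d) ≡ (a ℤ.+ c) ℤ.- (b ℤ.+ d)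
    rearrange = solve-∀

  inflow : (Vtx D → ℕ) → Vtx D → ℕ
  inflow x v = ∑[ e < m ] (𝟙 (head D e ≟ v) * x (tail D e))

  IsBalanced : (Vtx D → ℕ) → Set
  IsBalanced x = ∀ v → inflow x v ≡ outdeg D v * x v

  inflow-*ˡ : (c : ℕ) (x : Vtx D → ℕ) (v : Vtx D) → inflow (λ u → c * x u) v ≡ c * inflow x v
  inflow-*ˡ c x v = trans (sum-cong-≗ {m} λ e → x∙yz≈y∙xz (𝟙 (head D e ≟ v)) c (x (tail D e)))
                          (sym (*-distribˡ-sum {m} c _))

  outdeg≡∑ : ∀ v → outdeg D v ≡ ∑[ e < m ] 𝟙 (tail D e ≟ v)
  outdeg≡∑ v = trans (length-filter≡sum-𝟙 (λ e → tail D e ≟ v) (allFin m)) (sum-map-allFin m _)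

  nEdges≡∑ : ∀ j i → nEdges D j i ≡ ∑[ e < m ] (𝟙 (head D e ≟ i) * 𝟙 (tail D e ≟ j))
  nEdges≡∑ j i = begin
    length (filter (λ e → tail D e ≟ j) (filter (λ e → head D e ≟ i) (allFin m)))
      ≡⟨ length-filter≡sum-𝟙 (λ e → tail D e ≟ j) (filter (λ e → head D e ≟ i) (allFin m)) ⟩
    sum (map (λ e → 𝟙 (tail D e ≟ j)) (filter (λ e → head D e ≟ i) (allFin m)))
      ≡⟨ sum-map-filter (λ e → head D e ≟ i) _ (allFin m) ⟩
    sum (map (λ e → 𝟙 (head D e ≟ i) * 𝟙 (tail D e ≟ j)) (allFin m))
      ≡⟨ sum-map-allFin m _ ⟩
    ∑[ e < m ] (𝟙 (head D e ≟ i) * 𝟙 (tail D e ≟ j)) ∎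
    where open ≡-Reasoning

  ∑-nEdges : (x : Vtx D → ℕ) (i : Vtx D) → ∑[ j < n ] (nEdges D j i * x j) ≡ inflow x i
  ∑-nEdges x i = begin
    ∑[ j < n ] (nEdges D j i * x j)
      ≡⟨ sum-cong-≗ {n} (λ j → cong (_* x j) (nEdges≡∑ j i)) ⟩
    ∑[ j < n ] (∑[ e < m ] (𝟙 (head D e ≟ i) * 𝟙 (tail D e ≟ j)) * x j)
      ≡⟨ sum-cong-≗ {n} (λ j → *-distribʳ-sum {m} (x j) _) ⟩
    ∑[ j < n ] ∑[ e < m ] (𝟙 (head D e ≟ i) * 𝟙 (tail D e ≟ j) * x j)
      ≡⟨ ∑-comm (λ j e → 𝟙 (head D e ≟ i) * 𝟙 (tail D e ≟ j) * x j) ⟩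
    ∑[ e < m ] ∑[ j < n ] (𝟙 (head D e ≟ i) * 𝟙 (tail D e ≟ j) * x j)
      ≡⟨ sum-cong-≗ {m} (λ e → sum-cong-≗ {n} λ j → *-assoc (𝟙 (head D e ≟ i)) _ (x j)) ⟩
    ∑[ e < m ] ∑[ j < n ] (𝟙 (head D e ≟ i) * (𝟙 (tail D e ≟ j) * x j))
      ≡⟨ sum-cong-≗ {m} (λ e → *-distribˡ-sum {n} (𝟙 (head D e ≟ i)) _) ⟨
    ∑[ e < m ] (𝟙 (head D e ≟ i) * ∑[ j < n ] (𝟙 (tail D e ≟ j) * x j))
      ≡⟨ sum-cong-≗ {m} (λ e → cong (𝟙 (head D e ≟ i) *_) (∑-pick (tail D e) x)) ⟩
    inflow x i ∎
    where open ≡-Reasoning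

  -- The diagonal term −d⁺(i)·x i is split as e(i,i)·x i − (d⁺(i) + e(i,i))·x i, so that
  -- row i becomes the inflow at i minus a single diagonal term.
  Laplacian-term : (x : Vtx D → ℕ) (i j : Vtx D) →
    Laplacian D i j ℤ.* + x j ≡
    + (nEdges D j i * x j) ℤ.- + (𝟙 (i ≟ j) * ((outdeg D i + nEdges D i i) * x j))
  Laplacian-term x i j with i ≟ j
  ... | yes refl = begin
    ℤ.- + d ℤ.* + x i                                  ≡⟨ diagonal (+ d) (+ e) (+ x i) ⟩
    + e ℤ.* + x i ℤ.- (+ d ℤ.+ + e) ℤ.* + x i          ≡⟨ cong₂ ℤ._-_ (ℤₚ.pos-* e (x i)) (cong (ℤ._* + x i) (ℤₚ.pos-+ d e)) ⟨
    + (e * x i) ℤ.- + (d + e) ℤ.* + x i                ≡⟨ cong (λ z → + (e * x i) ℤ.- z) (ℤₚ.pos-* (d + e) (x i)) ⟨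
    + (e * x i) ℤ.- + ((d + e) * x i)                  ≡⟨ cong (λ z → + (e * x i) ℤ.- + z) (*-identityˡ ((d + e) * x i)) ⟨
    + (e * x i) ℤ.- + (1 * ((d + e) * x i))            ∎
    where
    open ≡-Reasoning
    d e : ℕ
    d = outdeg D i
    e = nEdges D i i
    diagonal : ∀ d e x → ℤ.- d ℤ.* x ≡ e ℤ.* x ℤ.- (d ℤ.+ e) ℤ.* x
    diagonal = solve-∀
  ... | no _ = trans (sym (ℤₚ.pos-* (nEdges D j i) (x j))) (sym (ℤₚ.+-identityʳ _))

  Laplacian-row : (x : Vtx D → ℕ) (i : Vtx D) →
    sumℤ D (map (λ j → Laplacian D i j ℤ.* + x j) (allFin n)) ≡ + 0 →
    inflow x i ≡ (outdeg D i + nEdges D i i) * x i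
  Laplacian-row x i row = begin
    inflow x i                                  ≡⟨ ∑-nEdges x i ⟨
    ∑[ j < n ] (nEdges D j i * x j)             ≡⟨ sum-map-allFin n f ⟨
    sum (map f (allFin n))                      ≡⟨ ℤₚ.+-injective (ℤₚ.i-j≡0⇒i≡j _ _ row-in-ℤ) ⟩
    sum (map g (allFin n))                      ≡⟨ sum-map-allFin n g ⟩
    ∑[ j < n ] (𝟙 (i ≟ j) * (c * x j))          ≡⟨ ∑-pick i (λ j → c * x j) ⟩
    c * x i                                     ∎
    where
    open ≡-Reasoning
    c : ℕ
    c = outdeg D i + nEdges D i i
    f g : Vtx D → ℕ
    f j = nEdges D j i * x j
    g j = 𝟙 (i ≟ j) * (c * x j)
    row-in-ℤ : + sum (map f (allFin n)) ℤ.- + sum (map g (allFin n)) ≡ + 0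
    row-in-ℤ = trans (sym (sumℤ-⊖ f g (allFin n)))
                     (trans (cong (sumℤ D) (map-cong (λ j → sym (Laplacian-term x i j)) (allFin n))) row)

  ∑-inflow : (x : Vtx D → ℕ) → ∑[ v < n ] inflow x v ≡ ∑[ e < m ] x (tail D e)
  ∑-inflow x = trans (∑-comm (λ v e → 𝟙 (head D e ≟ v) * x (tail D e)))
                     (sum-cong-≗ {m} λ e → ∑-pick (head D e) λ _ → x (tail D e))

  ∑-outflow : (x : Vtx D → ℕ) → ∑[ v < n ] (outdeg D v * x v) ≡ ∑[ e < m ] x (tail D e)
  ∑-outflow x = begin
    ∑[ v < n ] (outdeg D v * x v)                            ≡⟨ sum-cong-≗ {n} (λ v → cong (_* x v) (outdeg≡∑ v)) ⟩
    ∑[ v < n ] (∑[ e < m ] 𝟙 (tail D e ≟ v) * x v)           ≡⟨ sum-cong-≗ {n} (λ v → *-distribʳ-sum {m} (x v) _) ⟩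
    ∑[ v < n ] ∑[ e < m ] (𝟙 (tail D e ≟ v) * x v)           ≡⟨ ∑-comm (λ v e → 𝟙 (tail D e ≟ v) * x v) ⟩
    ∑[ e < m ] ∑[ v < n ] (𝟙 (tail D e ≟ v) * x v)           ≡⟨ sum-cong-≗ {m} (λ e → ∑-pick (tail D e) x) ⟩
    ∑[ e < m ] x (tail D e)                                  ∎
    where open ≡-Reasoning

  InKernel : (Vtx D → ℕ) → Set
  InKernel x = ∀ i → sumℤ D (map (λ j → Laplacian D i j ℤ.* + x j) (allFin n)) ≡ + 0

  module _ {x : Vtx D → ℕ} (positive : ∀ v → 0 < x v) (kernel : InKernel x) where

    -- The diagonal of L_D is −d⁺ even at vertices with loops, so summing all rows of the kernel
    -- equation leaves Σ e(v,v)·x v = 0.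
    loopless : ∀ v → nEdges D v v ≡ 0
    loopless v = m*n≡0⇒m≡0 _ _ {{>-nonZero (positive v)}} (sym (∑≡∑⇒≗ (λ _ → z≤n) no-loop-flow v))
      where
      no-loop-flow : ∑[ v < n ] 0 ≡ ∑[ v < n ] (nEdges D v v * x v)
      no-loop-flow = +-cancelˡ-≡ (∑[ v < n ] (outdeg D v * x v)) _ _ (begin
        ∑[ v < n ] (outdeg D v * x v) + ∑[ v < n ] 0     ≡⟨ cong (λ s → ∑[ v < n ] (outdeg D v * x v) + s) (sum-replicate-zero n) ⟩
        ∑[ v < n ] (outdeg D v * x v) + 0                ≡⟨ +-identityʳ _ ⟩
        ∑[ v < n ] (outdeg D v * x v)                    ≡⟨ trans (∑-outflow x) (sym (∑-inflow x)) ⟩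
        ∑[ v < n ] inflow x v                            ≡⟨ sum-cong-≗ {n} (λ v → trans (Laplacian-row x v (kernel v)) (*-distribʳ-+ (x v) (outdeg D v) _)) ⟩
        ∑[ v < n ] (outdeg D v * x v + nEdges D v v * x v) ≡⟨ ∑-distrib-+ (λ v → outdeg D v * x v) _ ⟩
        ∑[ v < n ] (outdeg D v * x v) + ∑[ v < n ] (nEdges D v v * x v) ∎)
        where open ≡-Reasoning

    balanced : IsBalanced x
    balanced v = begin
      inflow x v                               ≡⟨ Laplacian-row x v (kernel v) ⟩
      (outdeg D v + nEdges D v v) * x v        ≡⟨ cong (λ k → (outdeg D v + k) * x v) (loopless v) ⟩
      (outdeg D v + 0) * x v                   ≡⟨ cong (_* x v) (+-identityʳ (outdeg D v)) ⟩
      outdeg D v * x v                         ∎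
      where open ≡-Reasoning

-- Balanced vectors are proportional

module _ {I : Set} {P K : I → ℕ} (positive : ∀ i → 0 < P i)
         (coprime : ∀ d → (∀ i → d ∣ P i) → d ≡ 1)
         (proportional : ∀ i j → K i * P j ≡ P i * K j)
         (K≤P : ∀ i → K i ≤ P i) where

  private instance
    P≢0 : ∀ {i} → NonZero (P i)
    P≢0 {i} = >-nonZero (positive i)

  -- In lowest terms K j / P j = num / den, and den divides every P i, so den = 1.
  ratio-integral : ∀ j → K j ≡ 0 ⊎ K j ≡ P j
  ratio-integral j = Sum.map (λ num≡0 → trans (sym num*Pj≡Kj) (cong (_* P j) num≡0))
                             (λ num≡1 → trans (sym num*Pj≡Kj) (trans (cong (_* P j) num≡1) (*-identityˡ (P j))))
                             (n≤1⇒n≡0∨n≡1 num≤1)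
    where
    g : ℕ
    g = gcd (P j) (K j)
    instance
      g≢0 : NonZero g
      g≢0 = ≢-nonZero (gcd[m,n]≢0 (P j) (K j) (inj₁ (≢-nonZero⁻¹ (P j))))
    den num : ℕ
    den = P j / g
    num = K j / g
    den*g≡Pj : den * g ≡ P j
    den*g≡Pj = m/n*n≡m (gcd[m,n]∣m (P j) (K j))
    num*g≡Kj : num * g ≡ K j
    num*g≡Kj = m/n*n≡m (gcd[m,n]∣n (P j) (K j))
    den∣P : ∀ i → den ∣ P i
    den∣P i = coprime-divisor (coprime-/gcd (P j) (K j)) (divides (K i) (*-cancelʳ-≡ _ _ g (begin
      num * P i * g     ≡⟨ xy∙z≈xz∙y num (P i) g ⟩
      num * g * P i     ≡⟨ cong (_* P i) num*g≡Kj ⟩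
      K j * P i         ≡⟨ proportional j i ⟩
      P j * K i         ≡⟨ cong (_* K i) den*g≡Pj ⟨
      den * g * K i     ≡⟨ xy∙z≈zx∙y den g (K i) ⟩
      K i * den * g     ∎)))
      where open ≡-Reasoning
    num*Pj≡Kj : num * P j ≡ K j
    num*Pj≡Kj = begin
      num * P j         ≡⟨ cong (num *_) den*g≡Pj ⟨
      num * (den * g)   ≡⟨ cong (λ d → num * (d * g)) (coprime den den∣P) ⟩
      num * (1 * g)     ≡⟨ cong (num *_) (*-identityˡ g) ⟩
      num * g           ≡⟨ num*g≡Kj ⟩
      K j               ∎
      where open ≡-Reasoning
    num≤1 : num ≤ 1
    num≤1 = *-cancelʳ-≤ num 1 (P j) (begin
      num * P j         ≡⟨ num*Pj≡Kj ⟩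
      K j               ≤⟨ K≤P j ⟩
      P j               ≡⟨ *-identityˡ (P j) ⟨
      1 * P j           ∎)
      where open ≤-Reasoning

  proportional-below-primitive : I → (∀ i → K i ≡ 0) ⊎ (∀ i → K i ≡ P i)
  proportional-below-primitive j with ratio-integral j
  ... | inj₁ Kj≡0  = inj₁ λ i → m*n≡0⇒m≡0 (K i) (P j)
                       (trans (proportional i j) (trans (cong (P i *_) Kj≡0) (*-zeroʳ (P i))))
  ... | inj₂ Kj≡Pj = inj₂ λ i → *-cancelʳ-≡ (K i) (P i) (P j) (trans (proportional i j) (cong (P i *_) Kj≡Pj))

module _ {a ℓ} {A : Set a} {_≼_ : Rel A ℓ} (≼-trans : Transitive _≼_) (≼-total : Total _≼_) where

  private
    ≼-refl : ∀ x → x ≼ x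
    ≼-refl x = Sum.[ id , id ]′ (≼-total x x)

  argmin : A → List A → A
  argmin x []       = x
  argmin x (y ∷ ys) with ≼-total y (argmin x ys)
  ... | inj₁ _ = y
  ... | inj₂ _ = argmin x ys

  argmin-≼ : ∀ x ys {z} → z ∈ x ∷ ys → argmin x ys ≼ z
  argmin-≼ x []       (here refl) = ≼-refl x
  argmin-≼ x (y ∷ ys) z∈ with ≼-total y (argmin x ys)
  argmin-≼ x (y ∷ ys) (here refl)         | inj₁ y≼m = ≼-trans y≼m (argmin-≼ x ys (here refl))
  argmin-≼ x (y ∷ ys) (there (here refl)) | inj₁ _   = ≼-refl y
  argmin-≼ x (y ∷ ys) (there (there z∈))  | inj₁ y≼m = ≼-trans y≼m (argmin-≼ x ys (there z∈))
  argmin-≼ x (y ∷ ys) (here refl)         | inj₂ _   = argmin-≼ x ys (here refl)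
  argmin-≼ x (y ∷ ys) (there (here refl)) | inj₂ m≼y = m≼y
  argmin-≼ x (y ∷ ys) (there (there z∈))  | inj₂ _   = argmin-≼ x ys (there z∈)

module _ (D : Digraph) {P K : Vtx D → ℕ} (positive : ∀ v → 0 < P v)
         (P-balanced : IsBalanced D P) (K-balanced : IsBalanced D K) where

  private
    instance
      P≢0 : ∀ {v} → NonZero (P v)
      P≢0 {v} = >-nonZero (positive v)

    -- u ≼ v  iff  K u / P u ≤ K v / P v
    _≼_ : Rel (Vtx D) _
    u ≼ v = K u * P v ≤ P u * K v

    ≼-trans : Transitive _≼_
    ≼-trans {u} {v} {w} u≼v v≼w = *-cancelʳ-≤ _ _ (P v) (begin
      K u * P w * P v     ≡⟨ xy∙z≈xz∙y (K u) (P w) (P v) ⟩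
      K u * P v * P w     ≤⟨ *-monoˡ-≤ (P w) u≼v ⟩
      P u * K v * P w     ≡⟨ *-assoc (P u) (K v) (P w) ⟩
      P u * (K v * P w)   ≤⟨ *-monoʳ-≤ (P u) v≼w ⟩
      P u * (P v * K w)   ≡⟨ x∙yz≈xz∙y (P u) (P v) (K w) ⟩
      P u * K w * P v     ∎)
      where open ≤-Reasoning

    ≼-total : Total _≼_
    ≼-total u v with ≤-total (K u * P v) (P u * K v)
    ... | inj₁ u≼v = inj₁ u≼v
    ... | inj₂ v≼u = inj₂ (subst₂ _≤_ (*-comm (P u) (K v)) (*-comm (K u) (P v)) v≼u)

  -- At a vertex where K/P is minimal, the balance equation leaves no slack for the in-neighbours.
  minimal-ratio-propagates : ∀ j → (∀ v → j ≼ v) → ∀ e →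
    K j * P (head D e) ≡ P j * K (head D e) → K j * P (tail D e) ≡ P j * K (tail D e)
  minimal-ratio-propagates j j-min e at-head = begin
    K j * P (tail D e)                                 ≡⟨ *-identityˡ _ ⟨
    1 * (K j * P (tail D e))                           ≡⟨ cong (_* (K j * P (tail D e))) (𝟙-yes (head D e ≟ v) refl) ⟨
    𝟙 (head D e ≟ v) * (K j * P (tail D e))            ≡⟨ ∑≡∑⇒≗ termwise sums e ⟩
    𝟙 (head D e ≟ v) * (P j * K (tail D e))            ≡⟨ cong (_* (P j * K (tail D e))) (𝟙-yes (head D e ≟ v) refl) ⟩
    1 * (P j * K (tail D e))                           ≡⟨ *-identityˡ _ ⟩
    P j * K (tail D e)                                 ∎
    where
    open ≡-Reasoning
    v : Vtx D
    v = head D e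
    termwise : ∀ e′ → 𝟙 (head D e′ ≟ v) * (K j * P (tail D e′)) ≤ 𝟙 (head D e′ ≟ v) * (P j * K (tail D e′))
    termwise e′ = *-monoʳ-≤ (𝟙 (head D e′ ≟ v)) (j-min (tail D e′))
    sums : inflow D (λ u → K j * P u) v ≡ inflow D (λ u → P j * K u) v
    sums = begin
      inflow D (λ u → K j * P u) v    ≡⟨ inflow-*ˡ D (K j) P v ⟩
      K j * inflow D P v              ≡⟨ cong (K j *_) (P-balanced v) ⟩
      K j * (outdeg D v * P v)        ≡⟨ x∙yz≈y∙xz (K j) (outdeg D v) (P v) ⟩
      outdeg D v * (K j * P v)        ≡⟨ cong (outdeg D v *_) at-head ⟩
      outdeg D v * (P j * K v)        ≡⟨ x∙yz≈y∙xz (outdeg D v) (P j) (K v) ⟩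
      P j * (outdeg D v * K v)        ≡⟨ cong (P j *_) (K-balanced v) ⟨
      P j * inflow D K v              ≡⟨ inflow-*ˡ D (P j) K v ⟨
      inflow D (λ u → P j * K u) v    ∎

  balanced-proportional : StronglyConnected D → ∀ u v → K u * P v ≡ P u * K v
  balanced-proportional strong u v = *-cancelʳ-≡ _ _ (P j) (begin
    K u * P v * P j       ≡⟨ xy∙z≈zx∙y (K u) (P v) (P j) ⟩
    P j * K u * P v       ≡⟨ cong (_* P v) (proportional-to-j u) ⟨
    K j * P u * P v       ≡⟨ xy∙z≈y∙xz (K j) (P u) (P v) ⟩
    P u * (K j * P v)     ≡⟨ cong (P u *_) (proportional-to-j v) ⟩
    P u * (P j * K v)     ≡⟨ x∙yz≈xz∙y (P u) (P j) (K v) ⟩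
    P u * K v * P j       ∎)
    where
    open ≡-Reasoning
    j : Vtx D
    j = argmin ≼-trans ≼-total u (allFin (nV D))
    j-min : ∀ v → j ≼ v
    j-min v = argmin-≼ ≼-trans ≼-total u (allFin (nV D)) (there (∈-allFin v))
    along-walk : ∀ x es → WalkL D x es j → K j * P x ≡ P j * K x
    along-walk x []       refl          = *-comm (K j) (P j)
    along-walk x (e ∷ es) (refl , walk) = minimal-ratio-propagates j j-min e (along-walk (head D e) es walk)
    proportional-to-j : ∀ x → K j * P x ≡ P j * K x
    proportional-to-j x = along-walk x (proj₁ (strong x j)) (proj₂ (strong x j))

-- Unicycles

module _ (D : Digraph) where

  walk-applyUpTo : (g : ℕ → Vtx D) (f : ℕ → Edge D) →
    (∀ i → tail D (f i) ≡ g i) → (∀ i → head D (f i) ≡ g (suc i)) →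
    ∀ k → WalkL D (g 0) (applyUpTo f k) (g k)
  walk-applyUpTo g f tail-f head-f zero    = refl
  walk-applyUpTo g f tail-f head-f (suc k) =
    tail-f 0 , subst (λ u → WalkL D u (applyUpTo (f ∘ suc) k) (g (suc k))) (sym (head-f 0))
                     (walk-applyUpTo (g ∘ suc) (f ∘ suc) (tail-f ∘ suc) (head-f ∘ suc) k)

  pointsTo : (Vtx D → Edge D) → Vtx D → Vtx D
  pointsTo ρ v = head D (ρ v)

  module _ {ρ : Vtx D → Edge D} (rotor : IsRotorConfig D ρ) where

    rotorCycle : ℕ → Vtx D → List (Edge D)
    rotorCycle q x = applyUpTo (λ i → ρ ((pointsTo ρ ^ i) x)) q

    periodic-rotorCycle : ∀ {x q} → IsMinimalPeriod (pointsTo ρ) x q →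
      IsCycleIn D (InRotorSet D ρ) (rotorCycle q x)
    periodic-rotorCycle {x} {q} period = nonempty , (x , closed) , distinct , All.applyUpTo⁺₁ _ q (λ _ → _ , refl)
      where
      open IsMinimalPeriod period
      open IsMinimalPeriodProperties period
      nonempty : rotorCycle q x ≢ []
      nonempty cycle≡[] = <⇒≢ positive (sym (trans (sym (length-applyUpTo _ q)) (cong length cycle≡[])))
      closed : WalkL D x (rotorCycle q x) x
      closed = subst (WalkL D x (rotorCycle q x)) returns
                 (walk-applyUpTo (λ i → (pointsTo ρ ^ i) x) _ (λ i → rotor _) (λ _ → refl) q)
      distinct : Unique (map (tail D) (rotorCycle q x))
      distinct = subst Unique (sym (map-applyUpTo _ (tail D) q))
        (Unique.applyUpTo⁺₁ _ q λ i<j j<q eq → <⇒≢ i<j (^-injective (<-trans i<j j<q) j<q (trans (sym (rotor _)) (trans eq (rotor _)))))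

    unicycle-cycle-reaches : ∀ {w x q} → IsUnicycle D w ρ → IsMinimalPeriod (pointsTo ρ) x q →
      ∃ λ k → (pointsTo ρ ^ k) x ≡ w
    unicycle-cycle-reaches {w} {x} {q} (es , _ , w∈es , unique) period
      with e , e∈es , w≡tail-e ← ∈-map⁻ (tail D) w∈es
      with k , _ , refl ← ∈-applyUpTo⁻ _ (proj₁ (unique (rotorCycle q x) (periodic-rotorCycle period) e) e∈es)
      = k , sym (trans w≡tail-e (rotor _))

eventually-periodic : ∀ {n} (f : Fin n → Fin n) (v : Fin n) →
  ∃ λ a → ∃ λ p → 0 < p × (f ^ p) ((f ^ a) v) ≡ (f ^ a) v
eventually-periodic {n} f v with i , j , i<j , fⁱv≡fʲv ← pigeonhole (n<1+n n) (λ i → (f ^ toℕ i) v) =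
  toℕ i , toℕ j ∸ toℕ i , m<n⇒0<n∸m i<j , (begin
    (f ^ (toℕ j ∸ toℕ i)) ((f ^ toℕ i) v)   ≡⟨ ^-+ f (toℕ j ∸ toℕ i) (toℕ i) v ⟨
    (f ^ (toℕ j ∸ toℕ i + toℕ i)) v         ≡⟨ cong (λ k → (f ^ k) v) (m∸n+n≡m (<⇒≤ i<j)) ⟩
    (f ^ toℕ j) v                           ≡⟨ fⁱv≡fʲv ⟨
    (f ^ toℕ i) v                           ∎)
  where open ≡-Reasoning

module _ (D : Digraph) {ρ : Vtx D → Edge D} (rotor : IsRotorConfig D ρ) {w : Vtx D} (unicycle : IsUnicycle D w ρ) where

  unicycle-reaches : ∀ v → ∃ λ k → (pointsTo D ρ ^ k) v ≡ w
  unicycle-reaches v with a , p , 0<p , periodic ← eventually-periodic (pointsTo D ρ) v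
    with q , period ← minimalPeriod _≟_ (pointsTo D ρ) _ 0<p periodic
    with k , reaches ← unicycle-cycle-reaches D rotor unicycle period
    = k + a , trans (^-+ (pointsTo D ρ) k a v) reaches

-- Turns of a rotor

module _ (D : Digraph) (nxt : Edge D → Edge D) where

  iter≡^ : ∀ k e → iter D k nxt e ≡ (nxt ^ k) e
  iter≡^ zero    e = refl
  iter≡^ (suc k) e = cong nxt (iter≡^ k e)

  turns : Edge D → ℕ → Edge D → ℕ
  turns x k e = Σ< k (λ j → 𝟙 ((nxt ^ suc j) x ≟ e))

  module _ (cyclic : IsCyclicOrdering D nxt) where

    private
      m : ℕ
      m = nE D

    tail-^ : ∀ k e → tail D ((nxt ^ k) e) ≡ tail D e
    tail-^ zero    e = refl
    tail-^ (suc k) e = trans (proj₁ cyclic _) (tail-^ k e)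

    module _ {x : Edge D} {q : ℕ} (period : IsMinimalPeriod nxt x q) where

      open IsMinimalPeriod period
      open IsMinimalPeriodProperties period

      orbit-count : ∀ e → Σ< q (λ j → 𝟙 ((nxt ^ j) x ≟ e)) ≡ 𝟙 (tail D e ≟ tail D x)
      orbit-count e with tail D e ≟ tail D x
      ... | no tail≢ = Σ<-zero _ q λ {j} _ →
        𝟙-no ((nxt ^ j) x ≟ e) λ nxtʲx≡e → tail≢ (trans (cong (tail D) (sym nxtʲx≡e)) (tail-^ j x))
      ... | yes tail≡ with k , nxtᵏx≡e ← proj₂ cyclic x e (sym tail≡) =
        ≤-antisym (Σ<-𝟙≤1 (λ j → (nxt ^ j) x ≟ e) q λ i<q j<q nxtⁱx≡e nxtʲx≡e →
                     ^-injective i<q j<q (trans nxtⁱx≡e (sym nxtʲx≡e)))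
                  (≤-trans (≤-reflexive (sym (𝟙-yes ((nxt ^ (k % q)) x ≟ e) reduced))) (≤Σ< _ (m%n<n k q)))
        where
        reduced : (nxt ^ (k % q)) x ≡ e
        reduced = trans (sym (^-mod-period k)) (trans (sym (iter≡^ k x)) nxtᵏx≡e)

      period≡outdeg : q ≡ outdeg D (tail D x)
      period≡outdeg = begin
        q                                                     ≡⟨ Σ<-const-1 q ⟨
        Σ< q (λ _ → 1)                                        ≡⟨ Σ<-cong (λ j → ∑-𝟙 ((nxt ^ j) x)) q ⟨
        Σ< q (λ j → ∑[ e < m ] 𝟙 ((nxt ^ j) x ≟ e))           ≡⟨ Σ<-∑-comm {m} q _ ⟩
        ∑[ e < m ] Σ< q (λ j → 𝟙 ((nxt ^ j) x ≟ e))           ≡⟨ sum-cong-≗ {m} orbit-count ⟩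
        ∑[ e < m ] 𝟙 (tail D e ≟ tail D x)                    ≡⟨ outdeg≡∑ D (tail D x) ⟨
        outdeg D (tail D x)                                   ∎
        where open ≡-Reasoning

      turns-period : ∀ e → turns x q e ≡ 𝟙 (tail D e ≟ tail D x)
      turns-period e = trans (+-cancelˡ-≡ (g 0) _ _ (begin
        g 0 + turns x q e     ≡⟨ Σ<-+ g 1 q ⟨
        Σ< (1 + q) g          ≡⟨ +-comm (Σ< q g) (g q) ⟩
        g q + Σ< q g          ≡⟨ cong (λ y → 𝟙 (y ≟ e) + Σ< q g) returns ⟩
        g 0 + Σ< q g          ∎)) (orbit-count e)
        where
        open ≡-Reasoning
        g : ℕ → ℕ
        g j = 𝟙 ((nxt ^ j) x ≟ e)

      turns-*+ : ∀ c r e → turns x (c * q + r) e ≡ c * 𝟙 (tail D e ≟ tail D x) + turns x r e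
      turns-*+ c r e = trans (Σ<-periodic (λ i → cong (λ y → 𝟙 (nxt y ≟ e)) (^-periodic i)) c r)
                             (cong (λ t → c * t + turns x r e) (turns-period e))

      turns-≤ : ∀ {k} c e → k ≤ c * q → turns x k e ≤ c
      turns-≤ {k} c e k≤cq = begin
        turns x k e                                   ≤⟨ Σ<-mono _ k≤cq ⟩
        turns x (c * q) e                             ≡⟨ cong (λ j → turns x j e) (+-identityʳ (c * q)) ⟨
        turns x (c * q + 0) e                         ≡⟨ turns-*+ c 0 e ⟩
        c * 𝟙 (tail D e ≟ tail D x) + 0               ≡⟨ +-identityʳ _ ⟩
        c * 𝟙 (tail D e ≟ tail D x)                   ≤⟨ *-monoʳ-≤ c (𝟙≤1 (tail D e ≟ tail D x)) ⟩
        c * 1                                         ≡⟨ *-identityʳ c ⟩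
        c                                             ∎
        where open ≤-Reasoning

      turns-self-< : ∀ {k} c → k < c * q → turns x k x < c
      turns-self-< {k} c k<cq = begin-strict
        turns x k x                                   ≡⟨ cong (λ j → turns x j x) k≡ ⟩
        turns x (k / q * q + k % q) x                 ≡⟨ turns-*+ (k / q) (k % q) x ⟩
        k / q * 𝟙 (tail D x ≟ tail D x) + turns x (k % q) x
                                                      ≡⟨ cong₂ (λ a b → k / q * a + b) (𝟙-yes (tail D x ≟ tail D x) refl) no-return-below-period ⟩
        k / q * 1 + 0                                 ≡⟨ trans (+-identityʳ _) (*-identityʳ _) ⟩
        k / q                                         <⟨ m<n*o⇒m/o<n k<cq ⟩
        c                                             ∎
        where
        open ≤-Reasoning
        k≡ : k ≡ k / q * q + k % q
        k≡ = trans (m≡m%n+[m/n]*n k q) (+-comm (k % q) _)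
        no-return-below-period : turns x (k % q) x ≡ 0
        no-return-below-period = Σ<-zero _ (k % q) λ {j} j<r →
          𝟙-no ((nxt ^ suc j) x ≟ x) (minimal z<s (<-≤-trans (s≤s j<r) (m%n<n k q)))

    cyclic-period : ∀ x → IsMinimalPeriod nxt x (outdeg D (tail D x))
    cyclic-period x with k , nxtᵏ[nxt-x]≡x ← proj₂ cyclic (nxt x) x (proj₁ cyclic x)
      with q , period ← minimalPeriod _≟_ nxt x (subst (0 <_) (+-comm 1 k) z<s)
                          (trans (^-+ nxt k 1 x) (trans (sym (iter≡^ k (nxt x))) nxtᵏ[nxt-x]≡x))
      = subst (IsMinimalPeriod nxt x) (period≡outdeg period) period

module RotorWalk (D : Digraph) {nxt : Edge D → Edge D} (cyclic : IsCyclicOrdering D nxt)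
                 (w : Vtx D) {ρ : Vtx D → Edge D} (rotor : IsRotorConfig D ρ) where

  private
    n m : ℕ
    n = nV D
    m = nE D

  rotor-period : ∀ v → IsMinimalPeriod nxt (ρ v) (outdeg D v)
  rotor-period v = subst (λ u → IsMinimalPeriod nxt (ρ v) (outdeg D u)) (rotor v) (cyclic-period D nxt cyclic (ρ v))

  chip : ℕ → Vtx D
  chip t = proj₁ (run D nxt (w , ρ) t)

  rotors : ℕ → Vtx D → Edge D
  rotors t = proj₂ (run D nxt (w , ρ) t)

  crossed : ℕ → Edge D
  crossed = traversed D nxt (w , ρ)

  departures : ℕ → Vtx D → ℕ
  departures t v = Σ< t (λ i → 𝟙 (chip i ≟ v))

  arrivals : ℕ → Vtx D → ℕ
  arrivals t v = Σ< t (λ i → 𝟙 (chip (suc i) ≟ v))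

  crossings : ℕ → Edge D → ℕ
  crossings t e = Σ< t (λ i → 𝟙 (crossed i ≟ e))

  visits≡departures : ∀ t v → visits D nxt (w , ρ) t v ≡ departures t v
  visits≡departures t v = trans (length-filter≡sum-𝟙 (λ i → chip i ≟ v) (upTo t)) (sum-map-upTo _ t)

  traversals≡crossings : ∀ t e → traversals D nxt (w , ρ) t e ≡ crossings t e
  traversals≡crossings t e = trans (length-filter≡sum-𝟙 (λ i → crossed i ≟ e) (upTo t)) (sum-map-upTo _ t)

  rotors≡^ : ∀ t v → rotors t v ≡ (nxt ^ departures t v) (ρ v)
  rotors≡^ zero    v = refl
  rotors≡^ (suc t) v with v ≟ chip t
  ... | yes refl = begin
    nxt (rotors t v)                                    ≡⟨ cong nxt (rotors≡^ t v) ⟩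
    (nxt ^ suc (departures t v)) (ρ v)                  ≡⟨ cong (λ k → (nxt ^ k) (ρ v)) (+-comm 1 (departures t v)) ⟩
    (nxt ^ (departures t v + 1)) (ρ v)                  ≡⟨ cong (λ k → (nxt ^ (departures t v + k)) (ρ v)) (𝟙-yes (v ≟ v) refl) ⟨
    (nxt ^ (departures t v + 𝟙 (v ≟ v))) (ρ v)          ∎
    where open ≡-Reasoning
  ... | no v≢chip = trans (rotors≡^ t v)
    (cong (λ k → (nxt ^ k) (ρ v)) (sym (trans (cong (departures t v +_) (𝟙-no (chip t ≟ v) (v≢chip ∘ sym))) (+-identityʳ _))))

  tail-crossed : ∀ t → tail D (crossed t) ≡ chip t
  tail-crossed t = begin
    tail D (nxt (rotors t (chip t)))                              ≡⟨ cong (tail D ∘ nxt) (rotors≡^ t (chip t)) ⟩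
    tail D ((nxt ^ suc (departures t (chip t))) (ρ (chip t)))     ≡⟨ tail-^ D nxt cyclic (suc (departures t (chip t))) (ρ (chip t)) ⟩
    tail D (ρ (chip t))                                           ≡⟨ rotor (chip t) ⟩
    chip t                                                        ∎
    where open ≡-Reasoning

  crossings≡turns : ∀ t e → crossings t e ≡ turns D nxt (ρ (tail D e)) (departures t (tail D e)) e
  crossings≡turns zero    e = refl
  crossings≡turns (suc t) e with chip t ≟ tail D e
  ... | yes chip≡tail = begin
    crossings t e + 𝟙 (crossed t ≟ e)                 ≡⟨ cong₂ _+_ (crossings≡turns t e) (cong (λ y → 𝟙 (y ≟ e)) crossed≡) ⟩
    turns D nxt (ρ u) (suc k) e                       ≡⟨ cong (λ j → turns D nxt (ρ u) j e) (+-comm 1 k) ⟩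
    turns D nxt (ρ u) (k + 1) e                       ∎
    where
    open ≡-Reasoning
    u : Vtx D
    u = tail D e
    k : ℕ
    k = departures t u
    crossed≡ : crossed t ≡ (nxt ^ suc k) (ρ u)
    crossed≡ = trans (cong (λ v → nxt (rotors t v)) chip≡tail) (cong nxt (rotors≡^ t u))
  ... | no chip≢tail = begin
    crossings t e + 𝟙 (crossed t ≟ e)                 ≡⟨ cong₂ _+_ (crossings≡turns t e) not-e ⟩
    turns D nxt (ρ u) k e + 0                         ≡⟨ +-identityʳ _ ⟩
    turns D nxt (ρ u) k e                             ≡⟨ cong (λ j → turns D nxt (ρ u) j e) (+-identityʳ k) ⟨
    turns D nxt (ρ u) (k + 0) e                       ∎
    where
    open ≡-Reasoning
    u : Vtx D
    u = tail D e
    k : ℕ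
    k = departures t u
    not-e : 𝟙 (crossed t ≟ e) ≡ 0
    not-e = 𝟙-no (crossed t ≟ e) λ crossed≡e → chip≢tail (trans (sym (tail-crossed t)) (cong (tail D) crossed≡e))

  arrivals≡∑ : ∀ t v → arrivals t v ≡ ∑[ e < m ] (𝟙 (head D e ≟ v) * crossings t e)
  arrivals≡∑ t v = begin
    Σ< t (λ i → 𝟙 (head D (crossed i) ≟ v))
      ≡⟨ Σ<-cong (λ i → ∑-pick (crossed i) (λ e → 𝟙 (head D e ≟ v))) t ⟨
    Σ< t (λ i → ∑[ e < m ] (𝟙 (crossed i ≟ e) * 𝟙 (head D e ≟ v)))
      ≡⟨ Σ<-∑-comm {m} t _ ⟩
    ∑[ e < m ] Σ< t (λ i → 𝟙 (crossed i ≟ e) * 𝟙 (head D e ≟ v))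
      ≡⟨ sum-cong-≗ {m} (λ e → Σ<-cong (λ i → *-comm (𝟙 (crossed i ≟ e)) _) t) ⟩
    ∑[ e < m ] Σ< t (λ i → 𝟙 (head D e ≟ v) * 𝟙 (crossed i ≟ e))
      ≡⟨ sum-cong-≗ {m} (λ e → Σ<-*ˡ (𝟙 (head D e ≟ v)) _ t) ⟩
    ∑[ e < m ] (𝟙 (head D e ≟ v) * crossings t e)  ∎
    where open ≡-Reasoning

  -- Every visit to v except the initial one is an arrival, every visit except the current one
  -- a departure.
  conservation : ∀ t v → arrivals t v + 𝟙 (w ≟ v) ≡ departures t v + 𝟙 (chip t ≟ v)
  conservation zero    v = refl
  conservation (suc t) v = begin
    arrivals t v + new + 𝟙 (w ≟ v)           ≡⟨ x+y+z≡x+z+y (arrivals t v) new _ ⟩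
    arrivals t v + 𝟙 (w ≟ v) + new           ≡⟨ cong (_+ new) (conservation t v) ⟩
    departures t v + 𝟙 (chip t ≟ v) + new    ∎
    where
    open ≡-Reasoning
    new : ℕ
    new = 𝟙 (chip (suc t) ≟ v)

  ∑-departures : ∀ t → ∑[ v < n ] departures t v ≡ t
  ∑-departures t = begin
    ∑[ v < n ] departures t v                     ≡⟨ Σ<-∑-comm {n} t _ ⟨
    Σ< t (λ i → ∑[ v < n ] 𝟙 (chip i ≟ v))        ≡⟨ Σ<-cong (λ i → ∑-𝟙 (chip i)) t ⟩
    Σ< t (λ _ → 1)                                ≡⟨ Σ<-const-1 t ⟩
    t                                             ∎
    where open ≡-Reasoning

  crossings-multiple : ∀ t e c → departures t (tail D e) ≡ c * outdeg D (tail D e) → crossings t e ≡ c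
  crossings-multiple t e c departures≡ = begin
    crossings t e                                             ≡⟨ crossings≡turns t e ⟩
    turns D nxt (ρ u) (departures t u) e                      ≡⟨ cong (λ k → turns D nxt (ρ u) k e) (trans departures≡ (sym (+-identityʳ _))) ⟩
    turns D nxt (ρ u) (c * outdeg D u + 0) e                  ≡⟨ turns-*+ D nxt cyclic (rotor-period u) c 0 e ⟩
    c * 𝟙 (tail D e ≟ tail D (ρ u)) + 0                       ≡⟨ cong (λ b → c * b + 0) (𝟙-yes (tail D e ≟ tail D (ρ u)) (sym (rotor u))) ⟩
    c * 1 + 0                                                 ≡⟨ trans (+-identityʳ _) (*-identityʳ c) ⟩
    c                                                         ∎
    where
    open ≡-Reasoning
    u : Vtx D
    u = tail D e

  arrivals≡inflow : ∀ t (x : Vtx D → ℕ) → (∀ e → crossings t e ≡ x (tail D e)) → ∀ v → arrivals t v ≡ inflow D x v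
  arrivals≡inflow t x crossings≡ v = trans (arrivals≡∑ t v) (sum-cong-≗ {m} λ e → cong (𝟙 (head D e ≟ v) *_) (crossings≡ e))

  arrivals≡departures : ∀ t → chip t ≡ w → ∀ v → arrivals t v ≡ departures t v
  arrivals≡departures t chip≡w v =
    +-cancelʳ-≡ _ _ _ (trans (conservation t v) (cong (λ u → departures t v + 𝟙 (u ≟ v)) chip≡w))

  crossings-rotor≡turns : ∀ t v → crossings t (ρ v) ≡ turns D nxt (ρ v) (departures t v) (ρ v)
  crossings-rotor≡turns t v = trans (crossings≡turns t (ρ v)) (cong (λ u → turns D nxt (ρ u) (departures t u) (ρ v)) (rotor v))

module FirstReturn (D : Digraph) {nxt : Edge D → Edge D} (cyclic : IsCyclicOrdering D nxt)
              (strong : StronglyConnected D)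
              (w : Vtx D) {ρ : Vtx D → Edge D} (rotor : IsRotorConfig D ρ) (unicycle : IsUnicycle D w ρ)
              {P : Vtx D → ℕ} (period-vector : IsPeriodVector D P) where

  open RotorWalk D cyclic w rotor

  private
    n m : ℕ
    n = nV D
    m = nE D
    positive : ∀ v → 0 < P v
    positive = proj₁ period-vector
    P-balanced : IsBalanced D P
    P-balanced = balanced D positive (proj₁ (proj₂ period-vector))

  full : Vtx D → ℕ
  full v = P v * outdeg D v

  τ : ℕ
  τ = ∑[ v < n ] full v

  Bounded : ℕ → Set
  Bounded t = ∀ v → departures t v ≤ full v

  inflow-P : ∀ v → inflow D P v ≡ full v
  inflow-P v = trans (P-balanced v) (*-comm (outdeg D v) (P v))

  crossings-bound : ∀ t → Bounded t → ∀ e → crossings t e ≤ P (tail D e)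
  crossings-bound t bounded e = subst (_≤ P u) (sym (crossings≡turns t e))
    (turns-≤ D nxt cyclic (rotor-period u) (P u) e (bounded u))
    where
    u : Vtx D
    u = tail D e

  arrivals-bound : ∀ t → Bounded t → ∀ v → arrivals t v ≤ full v
  arrivals-bound t bounded v = begin
    arrivals t v                                        ≡⟨ arrivals≡∑ t v ⟩
    ∑[ e < m ] (𝟙 (head D e ≟ v) * crossings t e)       ≤⟨ ∑-mono-≤ (λ e → *-monoʳ-≤ (𝟙 (head D e ≟ v)) (crossings-bound t bounded e)) ⟩
    inflow D P v                                        ≡⟨ inflow-P v ⟩
    full v                                              ∎
    where open ≤-Reasoning

  Unsaturated : ℕ → Vtx D → Set
  Unsaturated t v = departures t v < full v

  saturated-chip-at-w : ∀ t → Bounded t → ¬ Unsaturated t (chip t) → chip t ≡ w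
  saturated-chip-at-w t bounded saturated with w ≟ chip t
  ... | yes w≡chip = sym w≡chip
  ... | no  w≢chip = ⊥-elim (<⇒≱ (begin-strict
    full u                              <⟨ m<m+n (full u) z<s ⟩
    full u + 1                          ≡⟨ cong₂ _+_ (≤-antisym (bounded u) (≮⇒≥ saturated)) (𝟙-yes (u ≟ u) refl) ⟨
    departures t u + 𝟙 (u ≟ u)          ≡⟨ conservation t u ⟨
    arrivals t u + 𝟙 (w ≟ u)            ≡⟨ cong (arrivals t u +_) (𝟙-no (w ≟ u) w≢chip) ⟩
    arrivals t u + 0                    ≡⟨ +-identityʳ _ ⟩
    arrivals t u                        ∎) (arrivals-bound t bounded u))
    where
    open ≤-Reasoning
    u : Vtx D
    u = chip t

  unsaturated-propagates : ∀ t → Bounded t → chip t ≡ w →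
    ∀ v → Unsaturated t v → Unsaturated t (pointsTo D ρ v)
  unsaturated-propagates t bounded chip≡w v unsaturated = begin-strict
    departures t v′                                    ≡⟨ arrivals≡departures t chip≡w v′ ⟨
    arrivals t v′                                      ≡⟨ arrivals≡∑ t v′ ⟩
    ∑[ e < m ] (𝟙 (head D e ≟ v′) * crossings t e)     <⟨ ∑-mono-< termwise (ρ v) at-rotor ⟩
    inflow D P v′                                      ≡⟨ inflow-P v′ ⟩
    full v′                                            ∎
    where
    open ≤-Reasoning
    v′ : Vtx D
    v′ = pointsTo D ρ v
    termwise : ∀ e → 𝟙 (head D e ≟ v′) * crossings t e ≤ 𝟙 (head D e ≟ v′) * P (tail D e)
    termwise e = *-monoʳ-≤ (𝟙 (head D e ≟ v′)) (crossings-bound t bounded e)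
    at-rotor : 𝟙 (head D (ρ v) ≟ v′) * crossings t (ρ v) < 𝟙 (head D (ρ v) ≟ v′) * P (tail D (ρ v))
    at-rotor = subst (λ b → b * crossings t (ρ v) < b * P (tail D (ρ v))) (sym (𝟙-yes (head D (ρ v) ≟ v′) refl))
      (+-monoˡ-< 0 (subst₂ _<_ (sym (crossings-rotor≡turns t v)) (cong P (sym (rotor v)))
        (turns-self-< D nxt cyclic (rotor-period v) (P v) unsaturated)))

  saturation : ∀ t → Bounded t → ¬ Unsaturated t (chip t) → t ≡ τ
  saturation t bounded saturated = begin
    t                             ≡⟨ ∑-departures t ⟨
    ∑[ v < n ] departures t v     ≡⟨ sum-cong-≗ {n} (λ v → ≤-antisym (bounded v) (≮⇒≥ (all-saturated v))) ⟩
    τ                             ∎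
    where
    open ≡-Reasoning
    chip≡w : chip t ≡ w
    chip≡w = saturated-chip-at-w t bounded saturated
    along : ∀ k v → Unsaturated t v → Unsaturated t ((pointsTo D ρ ^ k) v)
    along zero    v unsaturated = unsaturated
    along (suc k) v unsaturated = unsaturated-propagates t bounded chip≡w _ (along k v unsaturated)
    all-saturated : ∀ v → ¬ Unsaturated t v
    all-saturated v unsaturated with k , reaches-w ← unicycle-reaches D rotor unicycle v =
      saturated (subst (Unsaturated t) (trans reaches-w (sym chip≡w)) (along k v unsaturated))

  bounded : ∀ t → t ≤ τ → Bounded t
  bounded zero    _    v = z≤n
  bounded (suc t) t<τ v with chip t ≟ v
  ... | no _  = subst (_≤ full v) (sym (+-identityʳ _)) (bounded t (<⇒≤ t<τ) v)
  ... | yes refl with departures t v <? full v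
  ...   | yes unsaturated = subst (_≤ full v) (+-comm 1 _) unsaturated
  ...   | no  saturated   = ⊥-elim (<⇒≢ t<τ (saturation t (bounded t (<⇒≤ t<τ)) saturated))

  departures-τ : ∀ v → departures τ v ≡ full v
  departures-τ = ∑≡∑⇒≗ (bounded τ ≤-refl) (∑-departures τ)

  crossings-τ : ∀ e → crossings τ e ≡ P (tail D e)
  crossings-τ e = crossings-multiple τ e (P (tail D e)) (departures-τ (tail D e))

  rotors-τ : ∀ v → rotors τ v ≡ ρ v
  rotors-τ v = trans (rotors≡^ τ v) (trans (cong (λ k → (nxt ^ k) (ρ v)) (departures-τ v))
                     (IsMinimalPeriodProperties.^-*-period (rotor-period v) (P v)))

  chip-τ : chip τ ≡ w
  chip-τ = 𝟙≡1⇒ (chip τ ≟ w) (trans (sym (+-cancelˡ-≡ (full w) _ _ (begin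
    full w + 𝟙 (w ≟ w)                ≡⟨ cong (_+ 𝟙 (w ≟ w)) (trans (sym (inflow-P w)) (sym (arrivals≡inflow τ P crossings-τ w))) ⟩
    arrivals τ w + 𝟙 (w ≟ w)          ≡⟨ conservation τ w ⟩
    departures τ w + 𝟙 (chip τ ≟ w)   ≡⟨ cong (_+ 𝟙 (chip τ ≟ w)) (departures-τ w) ⟩
    full w + 𝟙 (chip τ ≟ w)           ∎))) (𝟙-yes (w ≟ w) refl))
    where open ≡-Reasoning

  private instance
    outdeg≢0 : ∀ {v} → NonZero (outdeg D v)
    outdeg≢0 {v} = >-nonZero (IsMinimalPeriod.positive (rotor-period v))

  -- A return at time k yields the balanced vector K = departures / outdeg, squeezed between 0 and P.
  return-time-extremal : ∀ k → k < τ → chip k ≡ w → (∀ v → rotors k v ≡ ρ v) → k ≡ 0 ⊎ k ≡ τ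
  return-time-extremal k k<τ chip≡w rotors≡ρ =
    Sum.map (λ K≡0 → trans (∑-departures-via (λ _ → 0) K≡0) (sum-replicate-zero n)) (∑-departures-via P)
      (proportional-below-primitive positive (proj₂ (proj₂ period-vector))
         (balanced-proportional D positive P-balanced K-balanced strong) K≤P w)
    where
    outdeg∣departures : ∀ v → outdeg D v ∣ departures k v
    outdeg∣departures v = IsMinimalPeriodProperties.period-∣ (rotor-period v) (trans (sym (rotors≡^ k v)) (rotors≡ρ v))
    K : Vtx D → ℕ
    K v = _∣_.quotient (outdeg∣departures v)
    departures≡K*outdeg : ∀ v → departures k v ≡ K v * outdeg D v
    departures≡K*outdeg v = _∣_.equality (outdeg∣departures v)
    ∑-departures-via : ∀ x → (∀ v → K v ≡ x v) → k ≡ ∑[ v < n ] (x v * outdeg D v)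
    ∑-departures-via x K≡x = trans (sym (∑-departures k))
      (sum-cong-≗ {n} λ v → trans (departures≡K*outdeg v) (cong (_* outdeg D v) (K≡x v)))
    K≤P : ∀ v → K v ≤ P v
    K≤P v = *-cancelʳ-≤ (K v) (P v) (outdeg D v) (subst (_≤ full v) (departures≡K*outdeg v) (bounded k (<⇒≤ k<τ) v))
    K-balanced : IsBalanced D K
    K-balanced v = begin
      inflow D K v         ≡⟨ arrivals≡inflow k K (λ e → crossings-multiple k e (K (tail D e)) (departures≡K*outdeg (tail D e))) v ⟨
      arrivals k v         ≡⟨ arrivals≡departures k chip≡w v ⟩
      departures k v       ≡⟨ departures≡K*outdeg v ⟩
      K v * outdeg D v     ≡⟨ *-comm (K v) (outdeg D v) ⟩
      outdeg D v * K v     ∎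
      where open ≡-Reasoning

  no-early-return : ∀ k → 1 ≤ k → k < τ → ¬ _≈C_ D (run D nxt (w , ρ) k) (w , ρ)
  no-early-return k 1≤k k<τ (chip≡w , rotors≡ρ) =
    Sum.[ (λ k≡0 → <⇒≢ 1≤k (sym k≡0)) , <⇒≢ k<τ ]′ (return-time-extremal k k<τ chip≡w rotors≡ρ)

  τ-positive : 1 ≤ τ
  τ-positive = ≤-trans (*-mono-≤ (positive w) (IsMinimalPeriod.positive (rotor-period w))) (≤∑ full w)

theorem2 : (D : Digraph) (nxt : Fin (nE D) → Fin (nE D)) →
    IsCyclicOrdering D nxt → StronglyConnected D →
    (w : Fin (nV D)) (ρ : Fin (nV D) → Fin (nE D)) →
    IsRotorConfig D ρ → IsUnicycle D w ρ →
    (per : Fin (nV D) → ℕ) → IsPeriodVector D per →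
    Σ ℕ λ T → IsFirstReturn D nxt (w , ρ) T ×
      (∀ v → visits D nxt (w , ρ) T v ≡ per v * outdeg D v) ×
      (∀ e → traversals D nxt (w , ρ) T e ≡ per (tail D e)) ×
      (T ≡ sum (map (λ v → per v * outdeg D v) (allFin (nV D))))
theorem2 D nxt cyclic strong w ρ rotor unicycle per period-vector =
  τ , (τ-positive , (chip-τ , rotors-τ) , no-early-return) ,
  (λ v → trans (visits≡departures τ v) (departures-τ v)) ,
  (λ e → trans (traversals≡crossings τ e) (crossings-τ e)) ,
  sym (sum-map-allFin (nV D) full)
  where
  open FirstReturn D cyclic strong w rotor unicycle period-vector
  open RotorWalk D cyclic w rotor
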